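{- For every positive integer $n$, $\eta_{n+1}=A(n,3)$.
   Context: For $m\geq 2$, $f\colon\mathbb F_2^m\to\mathbb F_2$ and $i\in\{1,\ldots,m\}$, let $L_i\colon\mathbb F_2^m\to\mathbb F_2^m$ be $L_i(x_1,\ldots,x_m)=(x_1,\ldots,x_{i-1},f(x_1,\ldots,x_m),x_{i+1},\ldots,x_m)$. With $\mathrm{id}=12\cdots m$ the identity permutation, the SDS map is $F=[K_m,f,\mathrm{id}]=L_m\circ L_{m-1}\circ\cdots\circ L_1$ (the sequential dynamical system on the complete graph $K_m$ in which every vertex has vertex function $f$, updated in order $v_1,\dots,v_m$). The phase space $\Gamma(F)$ is the directed graph on vertex set $\mathbb F_2^m$ with an edge $\vec x\to F(\vec x)$ for each $\vec x$; a $2$-cycle is a set $\{\vec x,F(\vec x)\}$ with $F(\vec x)\neq\vec x$ and $F(F(\vec x))=\vec x$. $\eta_m$ denotes the maximum, over all functions $f\colon\mathbb F_2^m\to\mathbb F_2$, of the number of $2$-cycles of $\Gamma([K_m,f,\mathrm{id}])$. $A(n,3)$ denotes the maximum number of codewords in a binary code $C\subseteq\mathbb F_2^n$ with minimum Hamming distance at least $3$ (any two distinct codewords differ in at least $3$ coordinates; a code with a single codeword counts as having minimum distance $\infty$). -}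

module Defs where

open import Data.Bool using (Bool; true; false; _xor_)
open import Data.Nat using (ℕ; zero; suc; _+_; _≤_; ⌊_/2⌋)
open import Data.Fin using (Fin)
open import Data.Vec using (Vec; []; _∷_; _[_]≔_)
open import Data.Vec.Properties using (≡-dec)
import Data.Bool.Properties as BoolP
open import Data.List using (List; []; _∷_; length; filter; map; _++_; foldl; allFin)
open import Data.List.Relation.Unary.AllPairs using (AllPairs)
open import Data.Product using (Σ; _×_)
open import Relation.Binary.PropositionalEquality using (_≡_)
open import Relation.Nullary using (¬_; _×-dec_; ¬?)

-- F_2 is Bool (false = 0, true = 1); F_2^m is Vec Bool m.
BV : ℕ → Set
BV m = Vec Bool m

_≟v_ : ∀ {m} → (x y : BV m) → Relation.Nullary.Dec (x ≡ y)
_≟v_ = ≡-dec BoolP._≟_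

allVecs : (m : ℕ) → List (BV m)
allVecs zero = [] ∷ []
allVecs (suc m) = map (false ∷_) (allVecs m) ++ map (true ∷_) (allVecs m)

L : ∀ {m} → (BV m → Bool) → Fin m → BV m → BV m
L f i x = x [ i ]≔ f x

-- SDS map [K_m, f, id] = L_m ∘ ... ∘ L_1 (apply L_1 first, then L_2, ...)
SDS : ∀ m → (BV m → Bool) → BV m → BV m
SDS m f x = foldl (λ y i → L f i y) x (allFin m)

-- number of 2-cycles of the phase space: points x with F x ≠ x and F (F x) = x,
-- each 2-cycle {x, F x} contains exactly two such points
twoCycles : ∀ m → (BV m → Bool) → ℕ
twoCycles m f = ⌊ length (filter (λ x → ¬? (F x ≟v x) ×-dec (F (F x) ≟v x)) (allVecs m)) /2⌋
  where F = SDS m f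

IsEta : ℕ → ℕ → Set
IsEta m k = Σ (BV m → Bool) (λ f → twoCycles m f ≡ k) × (∀ (f : BV m → Bool) → twoCycles m f ≤ k)

dist : ∀ {n} → BV n → BV n → ℕ
dist [] [] = 0
dist (a ∷ x) (b ∷ y) = (if a xor b then 1 else 0) + dist x y
  where open import Data.Bool using (if_then_else_)

-- a code in F_2^n with minimum distance ≥ d, given as a list of codewords
-- any two of which (at distinct list positions) are at distance ≥ d
-- (in particular the codewords are distinct when d ≥ 1)
IsCode : ∀ n → ℕ → List (BV n) → Set
IsCode n d C = AllPairs (λ x y → d ≤ dist x y) C

IsA : ℕ → ℕ → ℕ → Set
IsA n d k = Σ (List (BV n)) (λ C → IsCode n d C × length C ≡ k)
          × (∀ (C : List (BV n)) → IsCode n d C → length C ≤ k)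

-- A 2-cycle {x, y} of the sweep is a complementary pair y = ¬x: if x and y agree in coordinate i,
-- the update of coordinate i leaves the current state unchanged, so on each sweep the updates of
-- coordinates i and i+1 read the same state and y_(i+1) = y_i = x_i = x_(i+1); through the last
-- coordinate the agreement wraps around to all of them.
-- Write x = integrate b c, where c ∈ F_2^n records where consecutive bits of x differ. The sweep
-- from x to ¬x passes through x and the words integrate (not b) (flip c j), so 2-cycles correspond
-- to the words c at whose neighbours f takes prescribed values (cycle words). Two cycle words at
-- Hamming distance 1 or 2 would prescribe contradictory values, so the cycle words form a code of
-- minimum distance 3; conversely a code of minimum distance 3 consists of cycle words of the
-- function that negates the bit which the 2-cycle of the nearest codeword overwrites next.

module Submission where

open import Defs
open import Data.Bool using (Bool; true; false; not; _xor_)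
open import Data.Bool.Properties using (not-involutive; not-¬; ¬-not; xor-same; xor-assoc; not-distribˡ-xor; not-distribʳ-xor; xor-annihilates-not)
open import Data.Nat using (ℕ; zero; suc; _+_; _≤_; _≤?_; z≤n; s≤s; ⌊_/2⌋; 2+)
open import Data.Nat.Properties using (module ≤-Reasoning; ≤-trans; ≤-antisym; +-comm; +-suc; suc-injective; 0≢1+n; ≤-refl; <⇒≤)
open import Data.Fin using (Fin; zero; suc; toℕ)
import Data.Fin.Properties as Fin
import Data.Fin as Fin
open import Data.Vec.Properties using (∷-injectiveʳ; lookup-map; updateAt-updateAt-local; updateAt-id; updateAt-commutes)
open import Data.Vec using ([]; _∷_; head; last; lookup; map; _[_]%=_)
open import Data.List using (List; []; _∷_; foldl; tabulate; filter; length; _++_)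
import Data.List as List
open import Data.List.Properties using (filter-++; length-++; filter-≐)
open import Data.List.Membership.Propositional using (_∈_)
open import Data.List.Membership.Propositional.Properties using (∈-map⁺; ∈-map⁻; ∈-++⁺ˡ; ∈-++⁺ʳ; ∈-filter⁺; ∈-filter⁻)
open import Data.List.Relation.Unary.All.Properties using (all-filter)
open import Data.List.Extrema.Nat using (argmax; argmax-all; f[xs]≤f[argmax])
open import Data.List.Relation.Binary.Subset.Propositional using (_⊆_)
open import Data.List.Relation.Binary.Disjoint.Propositional using (Disjoint)
open import Data.List.Relation.Unary.Unique.Propositional using (Unique)
import Data.List.Relation.Unary.Unique.Propositional.Properties as Unique
open import Data.List.Relation.Unary.Any using (here; there; _─_)
import Data.List.Relation.Unary.Any as Any
import Data.List.Relation.Unary.All as All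
open import Data.List.Relation.Unary.AllPairs using (AllPairs; _∷_; allPairs?)
import Data.List.Relation.Unary.AllPairs as AllPairs
open import Data.Sum using (_⊎_; inj₁; inj₂)
open import Data.Product using (Σ; _×_; _,_; proj₁; proj₂; ∃-syntax; ∃₂)
import Data.Product as Product
open import Data.Empty using (⊥-elim)
open import Function using (_∘_)
open import Relation.Unary using (Pred; Decidable; _≐_)
open import Level using (0ℓ)
open import Relation.Nullary using (¬_; Dec; yes; no; ¬?; _×-dec_)
open import Relation.Binary.PropositionalEquality

AllPairs-lookup : ∀ {A : Set} {R : A → A → Set} {xs x y} → AllPairs R xs → x ∈ xs → y ∈ xs → x ≢ y → R x y ⊎ R y x
AllPairs-lookup (Rx ∷ _)   (here refl) (here refl) x≢y = ⊥-elim (x≢y refl)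
AllPairs-lookup (Rx ∷ _)   (here refl) (there y∈) _    = inj₁ (All.lookup Rx y∈)
AllPairs-lookup (Rx ∷ _)   (there x∈)  (here refl) _   = inj₂ (All.lookup Rx x∈)
AllPairs-lookup (_ ∷ Rxs) (there x∈)  (there y∈)  x≢y = AllPairs-lookup Rxs x∈ y∈ x≢y

AllPairs-tabulate : ∀ {A : Set} {R : A → A → Set} {xs} → Unique xs →
                    (∀ {x y} → x ∈ xs → y ∈ xs → x ≢ y → R x y) → AllPairs R xs
AllPairs-tabulate AllPairs.[] _ = AllPairs.[]
AllPairs-tabulate (x∉ ∷ uxs) R = All.tabulate (λ y∈ → R (here refl) (there y∈) (All.lookup x∉ y∈))
                              ∷ AllPairs-tabulate uxs (λ x∈ y∈ → R (there x∈) (there y∈))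

∈-─ : ∀ {A : Set} {x y : A} {ys} (x∈ys : x ∈ ys) → y ∈ ys → y ≢ x → y ∈ (ys ─ x∈ys)
∈-─ (here refl) (here refl) y≢x = ⊥-elim (y≢x refl)
∈-─ (here refl) (there y∈)  _   = y∈
∈-─ (there x∈)  (here refl) _   = here refl
∈-─ (there x∈)  (there y∈)  y≢x = there (∈-─ x∈ y∈ y≢x)

length-─ : ∀ {A : Set} {x : A} {ys} (x∈ys : x ∈ ys) → suc (length (ys ─ x∈ys)) ≡ length ys
length-─ (here refl) = refl
length-─ (there x∈)  = cong suc (length-─ x∈)

Unique-⊆⇒length-≤ : ∀ {A : Set} {xs ys : List A} → Unique xs → xs ⊆ ys → length xs ≤ length ys
Unique-⊆⇒length-≤ {xs = []}     _          _   = z≤n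
Unique-⊆⇒length-≤ {xs = x ∷ xs} {ys} (x∉ ∷ uxs) xs⊆ys = begin
  suc (length xs)          ≤⟨ s≤s (Unique-⊆⇒length-≤ uxs (λ y∈ → ∈-─ x∈ys (xs⊆ys (there y∈)) (All.lookup x∉ y∈ ∘ sym))) ⟩
  suc (length (ys ─ x∈ys)) ≡⟨ length-─ x∈ys ⟩
  length ys                ∎
  where
  open ≤-Reasoning
  x∈ys = xs⊆ys (here refl)

count : ∀ {A : Set} {P : Pred A 0ℓ} → Decidable P → List A → ℕ
count P? xs = length (filter P? xs)

count-map : ∀ {A B : Set} {P : Pred B 0ℓ} (P? : Decidable P) (g : A → B) xs → count P? (List.map g xs) ≡ count (P? ∘ g) xs
count-map P? g []       = refl
count-map P? g (x ∷ xs) with P? (g x)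
... | yes _ = cong suc (count-map P? g xs)
... | no _  = count-map P? g xs

count-≐ : ∀ {A : Set} {P Q : Pred A 0ℓ} (P? : Decidable P) (Q? : Decidable Q) → P ≐ Q → ∀ xs → count P? xs ≡ count Q? xs
count-≐ P? Q? P≐Q xs = cong length (filter-≐ P? Q? P≐Q xs)

sublists : ∀ {A : Set} → List A → List (List A)
sublists []       = [] ∷ []
sublists (x ∷ xs) = List.map (x ∷_) (sublists xs) ++ sublists xs

filter∈sublists : ∀ {A : Set} {P : Pred A 0ℓ} (P? : Decidable P) xs → filter P? xs ∈ sublists xs
filter∈sublists P? []       = here refl
filter∈sublists P? (x ∷ xs) with P? x
... | yes _ = ∈-++⁺ˡ (∈-map⁺ (x ∷_) (filter∈sublists P? xs))
... | no _  = ∈-++⁺ʳ _ (filter∈sublists P? xs)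

∈-allVecs : ∀ {n} (v : BV n) → v ∈ allVecs n
∈-allVecs []          = here refl
∈-allVecs (false ∷ v) = ∈-++⁺ˡ (∈-map⁺ (false ∷_) (∈-allVecs v))
∈-allVecs (true ∷ v)  = ∈-++⁺ʳ _ (∈-map⁺ (true ∷_) (∈-allVecs v))

allVecs-unique : ∀ n → Unique (allVecs n)
allVecs-unique zero    = All.[] ∷ AllPairs.[]
allVecs-unique (suc n) = Unique.++⁺ (Unique.map⁺ ∷-injectiveʳ (allVecs-unique n))
                                    (Unique.map⁺ ∷-injectiveʳ (allVecs-unique n))
                                    heads-differ
  where
  heads-differ : Disjoint (List.map (false ∷_) (allVecs n)) (List.map (true ∷_) (allVecs n))
  heads-differ (v∈ , v∈') with ∈-map⁻ (false ∷_) v∈ | ∈-map⁻ (true ∷_) v∈'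
  ... | _ , _ , refl | _ , _ , ()

count-allVecs-suc : ∀ n {P : Pred (BV (suc n)) 0ℓ} (P? : Decidable P) →
                    count P? (allVecs (suc n)) ≡ count (P? ∘ (false ∷_)) (allVecs n) + count (P? ∘ (true ∷_)) (allVecs n)
count-allVecs-suc n P? = begin
  length (filter P? (heads false ++ heads true))             ≡⟨ cong length (filter-++ P? (heads false) (heads true)) ⟩
  length (filter P? (heads false) ++ filter P? (heads true)) ≡⟨ length-++ (filter P? (heads false)) ⟩
  count P? (heads false) + count P? (heads true)             ≡⟨ cong₂ _+_ (count-map P? (false ∷_) (allVecs n)) (count-map P? (true ∷_) (allVecs n)) ⟩
  count (P? ∘ (false ∷_)) (allVecs n) + count (P? ∘ (true ∷_)) (allVecs n) ∎
  where
  open ≡-Reasoning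
  heads : Bool → List (BV (suc n))
  heads b = List.map (b ∷_) (allVecs n)

sweep-tail : ∀ {n k} (f : BV (suc n) → Bool) (h : Fin k → Fin n) b v →
             foldl (λ y i → L f i y) (b ∷ v) (tabulate (suc ∘ h))
             ≡ b ∷ foldl (λ y i → L (λ w → f (b ∷ w)) i y) v (tabulate h)
sweep-tail {k = zero}  f h b v = refl
sweep-tail {k = suc k} f h b v = sweep-tail f (h ∘ suc) b _

SDS-∷ : ∀ n (f : BV (suc n) → Bool) a x →
        SDS (suc n) f (a ∷ x) ≡ f (a ∷ x) ∷ SDS n (λ w → f (f (a ∷ x) ∷ w)) x
SDS-∷ n f a x = sweep-tail f (λ i → i) (f (a ∷ x)) x

SDS-∷⁻ : ∀ {n} (g : BV (suc n) → Bool) {a b x y} → SDS (suc n) g (a ∷ x) ≡ b ∷ y →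
         g (a ∷ x) ≡ b × SDS n (λ w → g (b ∷ w)) x ≡ y
SDS-∷⁻ {n} g {a} {x = x} eq with trans (sym (SDS-∷ n g a x)) eq
... | refl = refl , refl

SDS-∷⁺ : ∀ {n} (g : BV (suc n) → Bool) {a b x y} →
         g (a ∷ x) ≡ b → SDS n (λ w → g (b ∷ w)) x ≡ y → SDS (suc n) g (a ∷ x) ≡ b ∷ y
SDS-∷⁺ {n} g {a} {x = x} refl refl = SDS-∷ n g a x

-- splice k y x is the state just before the update of coordinate k on the way from x to y.
splice : ∀ {m} → Fin m → BV m → BV m → BV m
splice zero    y       x       = x
splice (suc k) (b ∷ y) (a ∷ x) = b ∷ splice k y x

SDS⇒update : ∀ {m} {f : BV m → Bool} {x y} → SDS m f x ≡ y → ∀ k → f (splice k y x) ≡ lookup y k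
SDS⇒update {f = f} {a ∷ x} {b ∷ y} eq zero    = proj₁ (SDS-∷⁻ f eq)
SDS⇒update {f = f} {a ∷ x} {b ∷ y} eq (suc k) = SDS⇒update (proj₂ (SDS-∷⁻ f eq)) k

update⇒SDS : ∀ {m} {f : BV m → Bool} {x y} → (∀ k → f (splice k y x) ≡ lookup y k) → SDS m f x ≡ y
update⇒SDS         {x = []}    {[]}    _       = refl
update⇒SDS {f = f} {a ∷ x}     {b ∷ y} updates = SDS-∷⁺ f (updates zero) (update⇒SDS (updates ∘ suc))

-- 2-cycles are complementary pairs

agreeing-heads⇒≡ : ∀ {n} (g h : BV (suc n) → Bool) {x y} →
                   SDS (suc n) g x ≡ y → SDS (suc n) h y ≡ x → head x ≡ head y → x ≡ y
agreeing-heads⇒≡ {zero}  g h {a ∷ []}    {.a ∷ []}    _   _   refl = refl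
agreeing-heads⇒≡ {suc n} g h {a ∷ c ∷ x} {.a ∷ d ∷ y} gxy hyx refl =
  cong (a ∷_) (agreeing-heads⇒≡ _ _ (proj₂ (SDS-∷⁻ g gxy)) (proj₂ (SDS-∷⁻ h hyx)) c≡d)
  where
  -- as the heads agree, the first update leaves each state unchanged, so the second one acts on it too
  c≡d : c ≡ d
  c≡d = begin
    c                  ≡⟨ sym (proj₁ (SDS-∷⁻ _ (proj₂ (SDS-∷⁻ h hyx)))) ⟩
    h (a ∷ d ∷ y)      ≡⟨ proj₁ (SDS-∷⁻ h hyx) ⟩
    a                  ≡⟨ sym (proj₁ (SDS-∷⁻ g gxy)) ⟩
    g (a ∷ c ∷ x)      ≡⟨ proj₁ (SDS-∷⁻ _ (proj₂ (SDS-∷⁻ g gxy))) ⟩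
    d                  ∎
    where open ≡-Reasoning

SDS-last-unchanged : ∀ {n} (g : BV (suc n) → Bool) {x y} → SDS (suc n) g x ≡ y → last x ≡ last y → g y ≡ last y
SDS-last-unchanged {zero}  g {a ∷ []} {.a ∷ []} gxy refl = proj₁ (SDS-∷⁻ g gxy)
SDS-last-unchanged {suc n} g {a ∷ x}  {b ∷ y}   gxy l    = SDS-last-unchanged _ (proj₂ (SDS-∷⁻ g gxy)) l

agreeing-lasts⇒agreeing-heads : ∀ {n} (f : BV (suc n) → Bool) {x y} →
                                SDS (suc n) f x ≡ y → SDS (suc n) f y ≡ x → last x ≡ last y → head x ≡ head y
agreeing-lasts⇒agreeing-heads f {a ∷ x} {b ∷ y} fxy fyx l = begin
  a            ≡⟨ sym (proj₁ (SDS-∷⁻ f fyx)) ⟩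
  f (b ∷ y)    ≡⟨ SDS-last-unchanged f fxy l ⟩
  last (b ∷ y) ≡⟨ sym l ⟩
  last (a ∷ x) ≡⟨ sym (SDS-last-unchanged f fyx (sym l)) ⟩
  f (a ∷ x)    ≡⟨ proj₁ (SDS-∷⁻ f fxy) ⟩
  b            ∎
  where open ≡-Reasoning

differing-lasts⇒complement : ∀ {n} (g h : BV (suc n) → Bool) {x y} →
                             SDS (suc n) g x ≡ y → SDS (suc n) h y ≡ x → last x ≢ last y → y ≡ map not x
differing-lasts⇒complement {zero}  g h {a ∷ []} {b ∷ []} _ _ a≢b = cong (_∷ []) (¬-not (a≢b ∘ sym))
differing-lasts⇒complement {suc n} g h {a ∷ x} {b ∷ y} gxy hyx l≢ =
  cong₂ _∷_ (¬-not (λ b≡a → l≢ (cong last (agreeing-heads⇒≡ g h gxy hyx (sym b≡a)))))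
            (differing-lasts⇒complement _ _ (proj₂ (SDS-∷⁻ g gxy)) (proj₂ (SDS-∷⁻ h hyx)) l≢)

twoCycle⇒complement : ∀ {n} (f : BV (suc n) → Bool) {x y} →
                     SDS (suc n) f x ≡ y → SDS (suc n) f y ≡ x → x ≢ y → y ≡ map not x
twoCycle⇒complement f fxy fyx x≢y =
  differing-lasts⇒complement f f fxy fyx (x≢y ∘ agreeing-heads⇒≡ f f fxy fyx ∘ agreeing-lasts⇒agreeing-heads f fxy fyx)

Swaps : ∀ {m} → (BV m → Bool) → BV m → BV m → Set
Swaps {m} f x y = SDS m f x ≡ y × SDS m f y ≡ x

swaps? : ∀ {m} (f : BV m → Bool) x y → Dec (Swaps f x y)
swaps? {m} f x y = (SDS m f x ≟v y) ×-dec (SDS m f y ≟v x)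

IsTwoCyclePoint : ∀ {m} → (BV m → Bool) → BV m → Set
IsTwoCyclePoint {m} f x = SDS m f x ≢ x × SDS m f (SDS m f x) ≡ x

twoCyclePoint? : ∀ {m} (f : BV m → Bool) x → Dec (IsTwoCyclePoint f x)
twoCyclePoint? {m} f x = ¬? (SDS m f x ≟v x) ×-dec (SDS m f (SDS m f x) ≟v x)

-- Difference coordinates

runningXor : ∀ {n} → Bool → BV n → BV n
runningXor b []      = []
runningXor b (u ∷ c) = (b xor u) ∷ runningXor (b xor u) c

integrate : ∀ {n} → Bool → BV n → BV (suc n)
integrate b c = b ∷ runningXor b c

differencesFrom : ∀ {n} → Bool → BV n → BV n
differencesFrom a []      = []
differencesFrom a (b ∷ x) = (a xor b) ∷ differencesFrom b x

differences : ∀ {n} → BV (suc n) → BV n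
differences (a ∷ x) = differencesFrom a x

differences-integrate : ∀ {n} b (c : BV n) → differences (integrate b c) ≡ c
differences-integrate b []      = refl
differences-integrate b (u ∷ c) = cong₂ _∷_ xor-cancelˡ (differences-integrate (b xor u) c)
  where
  xor-cancelˡ : b xor (b xor u) ≡ u
  xor-cancelˡ = trans (sym (xor-assoc b b u)) (cong (_xor u) (xor-same b))

map-not-runningXor : ∀ {n} b (c : BV n) → map not (runningXor b c) ≡ runningXor (not b) c
map-not-runningXor b []      = refl
map-not-runningXor b (u ∷ c) = cong₂ _∷_ (not-distribˡ-xor b u)
  (trans (map-not-runningXor (b xor u) c) (cong (λ z → runningXor z c) (not-distribˡ-xor b u)))

map-not-integrate : ∀ {n} b (c : BV n) → map not (integrate b c) ≡ integrate (not b) c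
map-not-integrate b c = cong (not b ∷_) (map-not-runningXor b c)

flip : ∀ {n} → BV n → Fin n → BV n
flip c j = c [ j ]%= not

flip-involutive : ∀ {n} (c : BV n) j → flip (flip c j) j ≡ c
flip-involutive c j = trans (updateAt-updateAt-local j c (not-involutive _)) (updateAt-id j c)

runningXor-flip-zero : ∀ {n} b u (c : BV n) → runningXor b (flip (u ∷ c) zero) ≡ map not (runningXor b (u ∷ c))
runningXor-flip-zero b u c = begin
  (b xor not u) ∷ runningXor (b xor not u) c   ≡⟨ cong (λ z → z ∷ runningXor z c) (sym (not-distribʳ-xor b u)) ⟩
  not (b xor u) ∷ runningXor (not (b xor u)) c ≡⟨ cong (not (b xor u) ∷_) (sym (map-not-runningXor (b xor u) c)) ⟩
  map not (runningXor b (u ∷ c))               ∎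
  where open ≡-Reasoning

runningXor-flip-≥ : ∀ {n} b (c : BV n) {j k} → j Fin.≤ k →
                    lookup (runningXor b (flip c j)) k ≡ not (lookup (runningXor b c) k)
runningXor-flip-≥ b (u ∷ c) {zero}  {k}     _         =
  trans (cong (λ v → lookup v k) (runningXor-flip-zero b u c)) (lookup-map k not (runningXor b (u ∷ c)))
runningXor-flip-≥ b (u ∷ c) {suc j} {suc k} (s≤s j≤k) = runningXor-flip-≥ (b xor u) c j≤k

runningXor-flip-< : ∀ {n} b (c : BV n) {j k} → k Fin.< j →
                    lookup (runningXor b (flip c j)) k ≡ lookup (runningXor b c) k
runningXor-flip-< b (u ∷ c) {suc j} {zero}  _         = refl
runningXor-flip-< b (u ∷ c) {suc j} {suc k} (s≤s k<j) = runningXor-flip-< (b xor u) c k<j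

splice-runningXor : ∀ {n} b (c : BV n) j → splice j (runningXor (not b) c) (runningXor b c) ≡ runningXor (not b) (flip c j)
splice-runningXor b (u ∷ c) zero    = cong (λ z → z ∷ runningXor z c) (sym (xor-annihilates-not b u))
splice-runningXor b (u ∷ c) (suc j) = cong ((not b xor u) ∷_)
  (subst (λ z → splice j (runningXor z c) (runningXor (b xor u) c) ≡ runningXor z (flip c j))
         (not-distribˡ-xor b u) (splice-runningXor (b xor u) c j))

splice-integrate : ∀ {n} b (c : BV n) j → splice (suc j) (integrate (not b) c) (integrate b c) ≡ integrate (not b) (flip c j)
splice-integrate b c j = cong (not b ∷_) (splice-runningXor b c j)

dist-self : ∀ {n} (x : BV n) → dist x x ≡ 0
dist-self []          = refl
dist-self (false ∷ x) = dist-self x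
dist-self (true ∷ x)  = dist-self x

dist-sym : ∀ {n} (x y : BV n) → dist x y ≡ dist y x
dist-sym []          []          = refl
dist-sym (false ∷ x) (false ∷ y) = dist-sym x y
dist-sym (false ∷ x) (true ∷ y)  = cong suc (dist-sym x y)
dist-sym (true ∷ x)  (false ∷ y) = cong suc (dist-sym x y)
dist-sym (true ∷ x)  (true ∷ y)  = dist-sym x y

dist≡0⇒≡ : ∀ {n} (x y : BV n) → dist x y ≡ 0 → x ≡ y
dist≡0⇒≡ []          []          _  = refl
dist≡0⇒≡ (false ∷ x) (false ∷ y) eq = cong (false ∷_) (dist≡0⇒≡ x y eq)
dist≡0⇒≡ (true ∷ x)  (true ∷ y)  eq = cong (true ∷_) (dist≡0⇒≡ x y eq)

dist≡suc⇒≢ : ∀ {n k} {x y : BV n} → dist x y ≡ suc k → x ≢ y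
dist≡suc⇒≢ {x = x} eq refl = 0≢1+n (trans (sym (dist-self x)) eq)

dist≡1⇒flip : ∀ {n} (x y : BV n) → dist x y ≡ 1 → ∃[ j ] y ≡ flip x j
dist≡1⇒flip []          []          ()
dist≡1⇒flip (false ∷ x) (false ∷ y) eq = Product.map suc (cong (false ∷_)) (dist≡1⇒flip x y eq)
dist≡1⇒flip (true ∷ x)  (true ∷ y)  eq = Product.map suc (cong (true ∷_)) (dist≡1⇒flip x y eq)
dist≡1⇒flip (false ∷ x) (true ∷ y)  eq = zero , cong (true ∷_) (sym (dist≡0⇒≡ x y (suc-injective eq)))
dist≡1⇒flip (true ∷ x)  (false ∷ y) eq = zero , cong (false ∷_) (sym (dist≡0⇒≡ x y (suc-injective eq)))

dist≡2⇒flip² : ∀ {n} (x y : BV n) → dist x y ≡ 2 → ∃₂ λ j j' → j Fin.< j' × y ≡ flip (flip x j) j'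
dist≡2⇒flip² []          []          ()
dist≡2⇒flip² (false ∷ x) (false ∷ y) eq with dist≡2⇒flip² x y eq
... | j , j' , j<j' , refl = suc j , suc j' , s≤s j<j' , refl
dist≡2⇒flip² (true ∷ x)  (true ∷ y)  eq with dist≡2⇒flip² x y eq
... | j , j' , j<j' , refl = suc j , suc j' , s≤s j<j' , refl
dist≡2⇒flip² (false ∷ x) (true ∷ y)  eq with dist≡1⇒flip x y (suc-injective eq)
... | j' , refl = zero , suc j' , s≤s z≤n , refl
dist≡2⇒flip² (true ∷ x)  (false ∷ y) eq with dist≡1⇒flip x y (suc-injective eq)
... | j' , refl = zero , suc j' , s≤s z≤n , refl

dist-flip : ∀ {n} (c : BV n) j → dist c (flip c j) ≡ 1
dist-flip (false ∷ c) zero    = cong suc (dist-self c)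
dist-flip (true ∷ c)  zero    = cong suc (dist-self c)
dist-flip (false ∷ c) (suc j) = dist-flip c j
dist-flip (true ∷ c)  (suc j) = dist-flip c j

dist-flip² : ∀ {n} (c : BV n) {j j'} → j ≢ j' → dist c (flip (flip c j) j') ≡ 2
dist-flip² (a ∷ c)     {zero}  {zero}   j≢j' = ⊥-elim (j≢j' refl)
dist-flip² (false ∷ c) {zero}  {suc j'} _    = cong suc (dist-flip c j')
dist-flip² (true ∷ c)  {zero}  {suc j'} _    = cong suc (dist-flip c j')
dist-flip² (false ∷ c) {suc j} {zero}   _    = cong suc (dist-flip c j)
dist-flip² (true ∷ c)  {suc j} {zero}   _    = cong suc (dist-flip c j)
dist-flip² (false ∷ c) {suc j} {suc j'} j≢j' = dist-flip² c (j≢j' ∘ cong suc)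
dist-flip² (true ∷ c)  {suc j} {suc j'} j≢j' = dist-flip² c (j≢j' ∘ cong suc)

-- Cycle words and codes

-- The sweep from integrate b c to integrate (not b) c performs its update of coordinate suc j
-- at the state integrate (not b) (flip c j).
ComplementUpdates : ∀ {n} → (BV (suc n) → Bool) → Bool → BV n → Set
ComplementUpdates f b c = f (integrate b c) ≡ not b
                        × (∀ j → f (integrate (not b) (flip c j)) ≡ lookup (runningXor (not b) c) j)

SDS-to-complement⁻ : ∀ {n} (f : BV (suc n) → Bool) b c →
                     SDS (suc n) f (integrate b c) ≡ integrate (not b) c → ComplementUpdates f b c
SDS-to-complement⁻ f b c eq = updates zero , λ j → trans (cong f (sym (splice-integrate b c j))) (updates (suc j))
  where updates = SDS⇒update {x = integrate b c} eq

SDS-to-complement⁺ : ∀ {n} (f : BV (suc n) → Bool) b c →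
                     ComplementUpdates f b c → SDS (suc n) f (integrate b c) ≡ integrate (not b) c
SDS-to-complement⁺ f b c (first , later) = update⇒SDS updates
  where
  updates : ∀ k → f (splice k (integrate (not b) c) (integrate b c)) ≡ lookup (integrate (not b) c) k
  updates zero    = first
  updates (suc j) = trans (cong f (splice-integrate b c j)) (later j)

IsCycleWord : ∀ {n} → (BV (suc n) → Bool) → BV n → Set
IsCycleWord f c = ComplementUpdates f false c × ComplementUpdates f true c

swaps⇒cycleWord : ∀ {n} (f : BV (suc n) → Bool) c → Swaps f (integrate false c) (integrate true c) → IsCycleWord f c
swaps⇒cycleWord f c (forth , back) = SDS-to-complement⁻ f false c forth , SDS-to-complement⁻ f true c back

cycleWord⇒swaps : ∀ {n} (f : BV (suc n) → Bool) c → IsCycleWord f c → Swaps f (integrate false c) (integrate true c)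
cycleWord⇒swaps f c (forth , back) = SDS-to-complement⁺ f false c forth , SDS-to-complement⁺ f true c back

twoCyclePoint⇒swaps : ∀ {n} (f : BV (suc n) → Bool) b c →
                      IsTwoCyclePoint f (integrate b c) → Swaps f (integrate b c) (integrate (not b) c)
twoCyclePoint⇒swaps {n} f b c (moves , returns) = forth , subst (λ y → SDS (suc n) f y ≡ integrate b c) forth returns
  where
  forth : SDS (suc n) f (integrate b c) ≡ integrate (not b) c
  forth = trans (twoCycle⇒complement f refl returns (moves ∘ sym)) (map-not-integrate b c)

swaps⇒twoCyclePoint : ∀ {n} (f : BV (suc n) → Bool) b c →
                      Swaps f (integrate b c) (integrate (not b) c) → IsTwoCyclePoint f (integrate b c)
swaps⇒twoCyclePoint {n} f b c (forth , back) =
  (λ fixed → not-¬ refl (cong head (trans (sym fixed) forth))) , trans (cong (SDS (suc n) f) forth) back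

swapsIntegrals? : ∀ {n} (f : BV (suc n) → Bool) → Decidable (λ c → Swaps f (integrate false c) (integrate true c))
swapsIntegrals? f c = swaps? f (integrate false c) (integrate true c)

cycleWords : ∀ {n} → (BV (suc n) → Bool) → List (BV n)
cycleWords f = filter (swapsIntegrals? f) (allVecs _)

count-allVecs-integrate : ∀ n {P : Pred (BV (suc n)) 0ℓ} (P? : Decidable P) →
                          count P? (allVecs (suc n)) ≡ count (P? ∘ integrate false) (allVecs n) + count (P? ∘ integrate true) (allVecs n)
count-allVecs-integrate zero    P? = trans (count-allVecs-suc zero P?) (cong₂ _+_ (singleton false) (singleton true))
  where
  singleton : ∀ b → count (P? ∘ (b ∷_)) (allVecs 0) ≡ count (P? ∘ integrate b) (allVecs 0)
  singleton b with P? (b ∷ [])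
  ... | yes _ = refl
  ... | no _  = refl
count-allVecs-integrate (suc n) P? = begin
  count P? (allVecs (2+ n))                                     ≡⟨ count-allVecs-suc (suc n) P? ⟩
  count (P? ∘ (false ∷_)) (allVecs (suc n)) + count (P? ∘ (true ∷_)) (allVecs (suc n))
    ≡⟨ cong₂ _+_ (count-allVecs-integrate n (P? ∘ (false ∷_))) (count-allVecs-integrate n (P? ∘ (true ∷_))) ⟩
  (ff + ft) + (tf + tt)                                         ≡⟨ cong ((ff + ft) +_) (+-comm tf tt) ⟩
  (ff + ft) + (tt + tf)                                         ≡⟨ sym (cong₂ _+_ (count-allVecs-suc n (P? ∘ integrate false)) (count-allVecs-suc n (P? ∘ integrate true))) ⟩
  count (P? ∘ integrate false) (allVecs (suc n)) + count (P? ∘ integrate true) (allVecs (suc n)) ∎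
  where
  open ≡-Reasoning
  -- the counts match up because integrate a (b ∷ c) reduces to a ∷ integrate (a xor b) c
  ff = count (λ c → P? (false ∷ integrate false c)) (allVecs n)
  ft = count (λ c → P? (false ∷ integrate true c)) (allVecs n)
  tf = count (λ c → P? (true ∷ integrate false c)) (allVecs n)
  tt = count (λ c → P? (true ∷ integrate true c)) (allVecs n)

⌊n+n/2⌋≡n : ∀ n → ⌊ n + n /2⌋ ≡ n
⌊n+n/2⌋≡n zero    = refl
⌊n+n/2⌋≡n (suc n) = trans (cong (λ m → ⌊ suc m /2⌋) (+-suc n n)) (cong suc (⌊n+n/2⌋≡n n))

twoCycles≡length-cycleWords : ∀ {n} (f : BV (suc n) → Bool) → twoCycles (suc n) f ≡ length (cycleWords f)
twoCycles≡length-cycleWords {n} f = begin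
  ⌊ count (twoCyclePoint? f) (allVecs (suc n)) /2⌋
    ≡⟨ cong ⌊_/2⌋ (count-allVecs-integrate n (twoCyclePoint? f)) ⟩
  ⌊ count (twoCyclePoint? f ∘ integrate false) (allVecs n) + count (twoCyclePoint? f ∘ integrate true) (allVecs n) /2⌋
    ≡⟨ cong ⌊_/2⌋ (cong₂ _+_ (count-≐ _ (swapsIntegrals? f) from-false (allVecs n))
                             (count-≐ _ (swapsIntegrals? f) from-true (allVecs n))) ⟩
  ⌊ length (cycleWords f) + length (cycleWords f) /2⌋
    ≡⟨ ⌊n+n/2⌋≡n _ ⟩
  length (cycleWords f) ∎
  where
  open ≡-Reasoning
  from-false = (λ {c} → twoCyclePoint⇒swaps f false c) , (λ {c} → swaps⇒twoCyclePoint f false c)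
  from-true  = (λ {c} → Product.swap ∘ twoCyclePoint⇒swaps f true c) , (λ {c} → swaps⇒twoCyclePoint f true c ∘ Product.swap)

module _ {n} (f : BV (suc n) → Bool) where

  private
    value : ∀ {c} → IsCycleWord f c → f (integrate true c) ≡ false
    value = proj₁ ∘ proj₂

    neighbour : ∀ {c} → IsCycleWord f c → ∀ j → f (integrate true (flip c j)) ≡ lookup (runningXor true c) j
    neighbour = proj₂ ∘ proj₁

  cycleWords-not-at-distance-1 : ∀ {c} j → IsCycleWord f c → ¬ IsCycleWord f (flip c j)
  cycleWords-not-at-distance-1 {c} j w w' = not-¬ refl (trans A≡false (sym notA≡false))
    where
    A = lookup (runningXor true c) j
    A≡false : A ≡ false
    A≡false = trans (sym (neighbour w j)) (value w')
    notA≡false : not A ≡ false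
    notA≡false = begin
      not A                                          ≡⟨ sym (runningXor-flip-≥ true c (≤-refl {toℕ j})) ⟩
      lookup (runningXor true (flip c j)) j          ≡⟨ sym (neighbour w' j) ⟩
      f (integrate true (flip (flip c j) j))         ≡⟨ cong (f ∘ integrate true) (flip-involutive c j) ⟩
      f (integrate true c)                           ≡⟨ value w ⟩
      false                                          ∎
      where open ≡-Reasoning

  cycleWords-not-at-distance-2 : ∀ {c j j'} → j Fin.< j' → IsCycleWord f c → ¬ IsCycleWord f (flip (flip c j) j')
  cycleWords-not-at-distance-2 {c} {j} {j'} j<j' w w' = not-¬ refl (trans Aj≡Aj' Aj'≡notAj)
    where
    u  = flip c j
    c' = flip u j'
    Aj  = lookup (runningXor true c) j
    Aj' = lookup (runningXor true c) j'
    Aj≡Aj' : Aj ≡ Aj'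
    Aj≡Aj' = begin
      Aj                                        ≡⟨ sym (neighbour w j) ⟩
      f (integrate true u)                      ≡⟨ cong (f ∘ integrate true) (sym (flip-involutive u j')) ⟩
      f (integrate true (flip c' j'))           ≡⟨ neighbour w' j' ⟩
      lookup (runningXor true c') j'            ≡⟨ runningXor-flip-≥ true u (≤-refl {toℕ j'}) ⟩
      not (lookup (runningXor true u) j')       ≡⟨ cong not (runningXor-flip-≥ true c (<⇒≤ j<j')) ⟩
      not (not Aj')                             ≡⟨ not-involutive Aj' ⟩
      Aj'                                       ∎
      where open ≡-Reasoning
    flip-c'-j : flip c' j ≡ flip c j'
    flip-c'-j = trans (updateAt-commutes j j' (Fin.<⇒≢ j<j') u) (cong (λ v → flip v j') (flip-involutive c j))
    Aj'≡notAj : Aj' ≡ not Aj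
    Aj'≡notAj = begin
      Aj'                                       ≡⟨ sym (neighbour w j') ⟩
      f (integrate true (flip c j'))            ≡⟨ cong (f ∘ integrate true) (sym flip-c'-j) ⟩
      f (integrate true (flip c' j))            ≡⟨ neighbour w' j ⟩
      lookup (runningXor true c') j             ≡⟨ runningXor-flip-< true u j<j' ⟩
      lookup (runningXor true u) j              ≡⟨ runningXor-flip-≥ true c (≤-refl {toℕ j}) ⟩
      not Aj                                    ∎
      where open ≡-Reasoning

  cycleWords-far : ∀ {c c'} → IsCycleWord f c → IsCycleWord f c' → c ≢ c' → 3 ≤ dist c c'
  cycleWords-far {c} {c'} w w' c≢c' with dist c c' in eq
  ... | 0 = ⊥-elim (c≢c' (dist≡0⇒≡ c c' eq))
  ... | 1 with dist≡1⇒flip c c' eq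
  ...   | j , refl = ⊥-elim (cycleWords-not-at-distance-1 j w w')
  cycleWords-far {c} {c'} w w' c≢c' | 2 with dist≡2⇒flip² c c' eq
  ...   | j , j' , j<j' , refl = ⊥-elim (cycleWords-not-at-distance-2 j<j' w w')
  cycleWords-far w w' c≢c' | suc (suc (suc _)) = s≤s (s≤s (s≤s z≤n))

cycleWords-isCode : ∀ {n} (f : BV (suc n) → Bool) → IsCode n 3 (cycleWords f)
cycleWords-isCode {n} f = AllPairs-tabulate (Unique.filter⁺ (swapsIntegrals? f) (allVecs-unique n))
                                            (λ c∈ c'∈ → cycleWords-far f (cycleWord c∈) (cycleWord c'∈))
  where
  cycleWord : ∀ {c} → c ∈ cycleWords f → IsCycleWord f c
  cycleWord c∈ = swaps⇒cycleWord f _ (proj₂ (∈-filter⁻ (swapsIntegrals? f) {xs = allVecs n} c∈))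

code-members-far : ∀ {n C} {x y : BV n} → IsCode n 3 C → x ∈ C → y ∈ C → x ≢ y → 3 ≤ dist x y
code-members-far {x = x} {y} code x∈ y∈ x≢y with AllPairs-lookup code x∈ y∈ x≢y
... | inj₁ far = far
... | inj₂ far = subst (3 ≤_) (dist-sym y x) far

code-unique : ∀ {n C} → IsCode n 3 C → Unique C
code-unique = AllPairs.map far⇒≢
  where
  far⇒≢ : ∀ {n} {x y : BV n} → 3 ≤ dist x y → x ≢ y
  far⇒≢ {x = x} far refl with () ← subst (3 ≤_) (dist-self x) far

-- zero if u ∈ C and suc j if flip u j ∈ C; words far from C are sent to zero.
locate : ∀ {n} → List (BV n) → BV n → Fin (suc n)
locate C u with Any.any? (u ≟v_) C
... | yes _ = zero
... | no _ with Fin.any? (λ j → Any.any? (flip u j ≟v_) C)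
...   | yes (j , _) = suc j
...   | no _        = zero

locate-member : ∀ {n} {C : List (BV n)} {c} → c ∈ C → locate C c ≡ zero
locate-member {C = C} {c} c∈ with Any.any? (c ≟v_) C
... | yes _ = refl
... | no c∉ = ⊥-elim (c∉ c∈)

locate-neighbour : ∀ {n} {C : List (BV n)} {c} j → IsCode n 3 C → c ∈ C → locate C (flip c j) ≡ suc j
locate-neighbour {C = C} {c} j code c∈ with Any.any? (flip c j ≟v_) C
... | yes flip∈ with s≤s () ← subst (3 ≤_) (dist-flip c j)
                                       (code-members-far code c∈ flip∈ (dist≡suc⇒≢ (dist-flip c j)))
... | no _ with Fin.any? (λ j' → Any.any? (flip (flip c j) j' ≟v_) C)
...   | no none = ⊥-elim (none (j , subst (_∈ C) (sym (flip-involutive c j)) c∈))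
...   | yes (j' , flip²∈) with j Fin.≟ j'
...     | yes refl = refl
...     | no j≢j' with s≤s (s≤s ()) ← subst (3 ≤_) (dist-flip² c j≢j')
                                           (code-members-far code c∈ flip²∈ (dist≡suc⇒≢ (dist-flip² c j≢j')))

-- Negates the bit that the sweep through the 2-cycle of the nearest codeword overwrites at this state.
decoder : ∀ {n} → List (BV n) → BV (suc n) → Bool
decoder C x = not (lookup x (locate C (differences x)))

decoder-integrate : ∀ {n} (C : List (BV n)) b c → decoder C (integrate b c) ≡ not (lookup (integrate b c) (locate C c))
decoder-integrate C b c = cong (λ u → not (lookup (integrate b c) (locate C u))) (differences-integrate b c)

codeword⇒cycleWord : ∀ {n} {C : List (BV n)} {c} → IsCode n 3 C → c ∈ C → IsCycleWord (decoder C) c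
codeword⇒cycleWord {C = C} {c} code c∈ = (first false , later true) , (first true , later false)
  where
  first : ∀ b → decoder C (integrate b c) ≡ not b
  first b = trans (decoder-integrate C b c) (cong (λ k → not (lookup (integrate b c) k)) (locate-member c∈))
  later : ∀ b j → decoder C (integrate b (flip c j)) ≡ lookup (runningXor b c) j
  later b j = begin
    decoder C (integrate b (flip c j))                          ≡⟨ decoder-integrate C b (flip c j) ⟩
    not (lookup (integrate b (flip c j)) (locate C (flip c j)))
      ≡⟨ cong (λ k → not (lookup (integrate b (flip c j)) k)) (locate-neighbour j code c∈) ⟩
    not (lookup (runningXor b (flip c j)) j)                    ≡⟨ cong not (runningXor-flip-≥ b c (≤-refl {toℕ j})) ⟩
    not (not (lookup (runningXor b c) j))                       ≡⟨ not-involutive _ ⟩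
    lookup (runningXor b c) j                                   ∎
    where open ≡-Reasoning

code-length≤cycleWords : ∀ {n C} → IsCode n 3 C → length C ≤ length (cycleWords (decoder C))
code-length≤cycleWords {n} {C} code = Unique-⊆⇒length-≤ (code-unique code) code⊆cycleWords
  where
  code⊆cycleWords : C ⊆ cycleWords (decoder C)
  code⊆cycleWords {c} c∈ = ∈-filter⁺ (swapsIntegrals? (decoder C)) (∈-allVecs c)
                                     (cycleWord⇒swaps _ c (codeword⇒cycleWord code c∈))

isCode? : ∀ n → Decidable (IsCode n 3)
isCode? n = allPairs? (λ x y → 3 ≤? dist x y)

longestCode : ∀ n → List (BV n)
longestCode n = argmax length [] (filter (isCode? n) (sublists (allVecs n)))

longestCode-isCode : ∀ n → IsCode n 3 (longestCode n)
longestCode-isCode n = argmax-all length AllPairs.[] (all-filter (isCode? n) (sublists (allVecs n)))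

cycleWords≤longestCode : ∀ {n} (f : BV (suc n) → Bool) → length (cycleWords f) ≤ length (longestCode n)
cycleWords≤longestCode {n} f = All.lookup (f[xs]≤f[argmax] {f = length} [] _)
  (∈-filter⁺ (isCode? n) (filter∈sublists _ (allVecs n)) (cycleWords-isCode f))

theorem2 : (n : ℕ) → 1 ≤ n → Σ ℕ (λ k → IsEta (suc n) k × IsA n 3 k)
theorem2 n _ = length B , ((decoder B , twoCycles-decoder) , twoCycles≤) , ((B , longestCode-isCode n , refl) , code≤)
  where
  B = longestCode n
  twoCycles≤ : ∀ f → twoCycles (suc n) f ≤ length B
  twoCycles≤ f = subst (_≤ length B) (sym (twoCycles≡length-cycleWords f)) (cycleWords≤longestCode f)
  twoCycles-decoder : twoCycles (suc n) (decoder B) ≡ length B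
  twoCycles-decoder = ≤-antisym (twoCycles≤ (decoder B))
    (subst (length B ≤_) (sym (twoCycles≡length-cycleWords (decoder B))) (code-length≤cycleWords (longestCode-isCode n)))
  code≤ : ∀ C → IsCode n 3 C → length C ≤ length B
  code≤ C code = ≤-trans (code-length≤cycleWords code) (cycleWords≤longestCode (decoder C))
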